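{- For every positive integer $n$: (i) $\ell_{12}(n!)\in\{1,5,7,11\}$ if and only if $s_3(n)=s_2(n)$; (ii) $\ell_{12}(n!)\in\{2,10\}$ if and only if $s_3(n)=s_2(n)+1$.
   Context: For an integer $b\ge2$ and a nonnegative integer $n=\sum_{j\ge0}a_jb^j$ with digits $a_j\in\{0,\dots,b-1\}$, $s_b(n)=\sum_j a_j$. For a positive integer $m$, write $m=12^{v}m'$ with $12\nmid m'$; then $\ell_{12}(m)\in\{1,\dots,11\}$ denotes the last nonzero digit of $m$ in base $12$, i.e. the residue of $m'$ modulo $12$. -}

module Defs where

open import Data.Nat using (ℕ; zero; suc; _+_; _*_; _≡ᵇ_)
open import Data.Nat.DivMod using (_/_; _%_)
open import Data.Bool using (if_then_else_)

-- Digit sum in base (suc (suc k)), i.e. base b = k+2 ≥ 2.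
-- A fuel argument is used for termination; fuel ≥ n suffices since n / b < n for n > 0.
digitSumFuel : ℕ → ℕ → ℕ → ℕ
digitSumFuel k zero    n = 0
digitSumFuel k (suc f) zero = 0
digitSumFuel k (suc f) n@(suc _) = n % suc (suc k) + digitSumFuel k f (n / suc (suc k))

s : ℕ → ℕ → ℕ
s k n = digitSumFuel k n n

s₂ : ℕ → ℕ
s₂ = s 0

s₃ : ℕ → ℕ
s₃ = s 1

-- last nonzero base-12 digit: strip factors of 12, then reduce mod 12 (fuel as above).
-- For m = 0 the value is 0 (irrelevant: only applied to m > 0).
lastNZFuel : ℕ → ℕ → ℕ
lastNZFuel zero    m = m % 12
lastNZFuel (suc f) zero = 0
lastNZFuel (suc f) m@(suc _) =
  if (m % 12) ≡ᵇ 0 then lastNZFuel f (m / 12) else m % 12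

ℓ₁₂ : ℕ → ℕ
ℓ₁₂ m = lastNZFuel m m

module Submission where

open import Defs
open import Data.Nat using (ℕ; suc; _+_; _≤_; _!)
open import Data.Product using (_×_)
open import Relation.Binary.PropositionalEquality using (_≡_)
open import Function.Bundles using (_⇔_)
open import Data.Sum using (_⊎_)

open import Data.Bool using (true; false)
open import Data.Empty using (⊥-elim)
open import Data.Nat
open import Data.Nat.Divisibility
open import Data.Nat.DivMod
open import Data.Nat.Induction using (<-wellFounded)
open import Data.Nat.Primality using (Prime; prime[2]; prime?; euclidsLemma; ¬prime[1])
open import Data.Nat.Properties
open import Data.Nat.Tactic.RingSolver using (solve-∀)
open import Data.Product using (Σ; _,_)
open import Data.Sum using (inj₁; inj₂; [_,_])
open import Function using (_∘_; const)
open import Function.Bundles using (mk⇔)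
open import Function.Properties.Equivalence using () renaming (trans to ⇔-trans)
open import Induction.WellFounded using (Acc; acc)
open import Relation.Binary.PropositionalEquality hiding ([_])
open import Relation.Nullary using (¬_; yes; no; contradiction)
open import Relation.Nullary.Decidable using (from-yes; from-no; _⊎-dec_)

open import Algebra.Properties.CommutativeSemigroup +-commutativeSemigroup using (xy∙z≈y∙xz)

-- By Legendre's formula, v₂(n!) = n − s₂(n) and 2·v₃(n!) = n − s₃(n), so s₃(n) − s₂(n) is
-- v₂(n!) − 2·v₃(n!).  Write n! = 2^a 3^b u with u prime to 6 and strip factors 12 = 2²·3:
-- the last nonzero base-12 digit is u mod 12, a unit, when a = 2b; it is 2u mod 12 ∈ {2, 10}
-- when a = 2b + 1; and in every other case it is divisible by 3 or by 4.

module _ (k : ℕ) where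

  private
    base : ℕ
    base = 2 + k

    n/base<n : ∀ n .{{_ : NonZero n}} → n / base < n
    n/base<n n = m/n<m n base (s≤s (s≤s z≤n))

  digitSumFuel-irrelevant : ∀ {f g} n → n ≤ f → n ≤ g → digitSumFuel k f n ≡ digitSumFuel k g n
  digitSumFuel-irrelevant {zero}  {zero}  zero _ _ = refl
  digitSumFuel-irrelevant {zero}  {suc _} zero _ _ = refl
  digitSumFuel-irrelevant {suc _} {zero}  zero _ _ = refl
  digitSumFuel-irrelevant {suc _} {suc _} zero _ _ = refl
  digitSumFuel-irrelevant {suc f} {suc g} n@(suc _) (s≤s n-1≤f) (s≤s n-1≤g) =
    cong (n % base +_) (digitSumFuel-irrelevant (n / base)
      (≤-trans (s≤s⁻¹ (n/base<n n)) n-1≤f) (≤-trans (s≤s⁻¹ (n/base<n n)) n-1≤g))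

  s-unfold : ∀ n → s k n ≡ n % base + s k (n / base)
  s-unfold zero      = refl
  s-unfold n@(suc _) = cong (n % base +_) (digitSumFuel-irrelevant (n / base) (s≤s⁻¹ (n/base<n n)) ≤-refl)

  s-digit : ∀ {r} q → r < base → s k (r + q * base) ≡ r + s k q
  s-digit {r} q r<base = begin
    s k n                      ≡⟨ s-unfold n ⟩
    n % base + s k (n / base)  ≡⟨ cong₂ (λ x y → x + s k y) n%base≡r n/base≡q ⟩
    r + s k q                  ∎
    where
    open ≡-Reasoning
    n = r + q * base
    n%base≡r : n % base ≡ r
    n%base≡r = trans ([m+kn]%n≡m%n r q base) (m<n⇒m%n≡m r<base)
    n/base≡q : n / base ≡ q
    n/base≡q = trans (+-distrib-/-∣ʳ r (n∣m*n q)) (cong₂ _+_ (m<n⇒m/n≡0 r<base) (m*n/n≡m q base))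

  -- Adding 1 to n turns its c trailing digits base − 1 into 0 and raises the next digit by 1.
  carry : ∀ c n w → suc n ≡ base ^ c * w → ¬ base ∣ w → c * suc k + s k (suc n) ≡ suc (s k n)
  carry zero n w 1+n≡w base∤w with m≤n⇒m<n∨m≡n (s≤s⁻¹ (m%n<n n base))
  ... | inj₁ r<1+k = begin
    s k (suc n)              ≡⟨ cong (s k ∘ suc) n≡r+q*base ⟩
    s k (suc r + q * base)   ≡⟨ s-digit q (s≤s r<1+k) ⟩
    suc (r + s k q)          ≡⟨ cong suc (s-digit q (m<n⇒m<1+n r<1+k)) ⟨
    suc (s k (r + q * base)) ≡⟨ cong (suc ∘ s k) n≡r+q*base ⟨
    suc (s k n)              ∎
    where
    open ≡-Reasoning
    r = n % base
    q = n / base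
    n≡r+q*base : n ≡ r + q * base
    n≡r+q*base = m≡m%n+[m/n]*n n base
  ... | inj₂ r≡1+k = contradiction (divides (suc (n / base)) w≡[1+q]*base) base∤w
    where
    open ≡-Reasoning
    w≡[1+q]*base : w ≡ suc (n / base) * base
    w≡[1+q]*base = begin
      w                                ≡⟨ +-identityʳ w ⟨
      1 * w                            ≡⟨ 1+n≡w ⟨
      suc n                            ≡⟨ cong suc (m≡m%n+[m/n]*n n base) ⟩
      suc (n % base + n / base * base) ≡⟨ cong (λ r → suc (r + n / base * base)) r≡1+k ⟩
      suc (n / base) * base            ∎
  carry (suc c) n w 1+n≡base^[1+c]*w base∤w =
    carry-multiple (base ^ c * w) refl (trans 1+n≡base^[1+c]*w (*-assoc base (base ^ c) w))
    where
    open ≡-Reasoning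
    carry-multiple : ∀ m′ → m′ ≡ base ^ c * w → suc n ≡ base * m′ →
                     suc k + c * suc k + s k (suc n) ≡ suc (s k n)
    carry-multiple zero    _ 1+n≡base*0 = contradiction (trans 1+n≡base*0 (*-zeroʳ base)) 1+n≢0
    carry-multiple (suc m) 1+m≡base^c*w 1+n≡base*[1+m] = begin
      suc k + c * suc k + s k (suc n)            ≡⟨ cong (λ x → suc k + c * suc k + s k x) 1+n≡[1+m]*base ⟩
      suc k + c * suc k + s k (0 + suc m * base) ≡⟨ cong (suc k + c * suc k +_) (s-digit (suc m) (s≤s z≤n)) ⟩
      suc k + c * suc k + s k (suc m)            ≡⟨ +-assoc (suc k) (c * suc k) (s k (suc m)) ⟩
      suc k + (c * suc k + s k (suc m))          ≡⟨ cong (suc k +_) (carry c m w 1+m≡base^c*w base∤w) ⟩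
      suc k + suc (s k m)                        ≡⟨ +-suc (suc k) (s k m) ⟩
      suc (suc k + s k m)                        ≡⟨ cong suc (s-digit m ≤-refl) ⟨
      suc (s k (suc k + m * base))               ≡⟨ cong (suc ∘ s k) n≡1+k+m*base ⟨
      suc (s k n)                                ∎
      where
      1+n≡[1+m]*base : suc n ≡ suc m * base
      1+n≡[1+m]*base = trans 1+n≡base*[1+m] (*-comm base (suc m))
      n≡1+k+m*base : n ≡ suc k + m * base
      n≡1+k+m*base = suc-injective (trans 1+n≡base*[1+m] (trans (*-suc base m) (cong (base +_) (*-comm base m))))

  legendre-step : ∀ {n v} c w → v * suc k + s k n ≡ n → suc n ≡ base ^ c * w → ¬ base ∣ w →
                  (c + v) * suc k + s k (suc n) ≡ suc n
  legendre-step {n} {v} c w legendre-n 1+n≡base^c*w base∤w = begin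
    (c + v) * suc k + s k (suc n)         ≡⟨ cong (_+ s k (suc n)) (*-distribʳ-+ (suc k) c v) ⟩
    c * suc k + v * suc k + s k (suc n)   ≡⟨ xy∙z≈y∙xz (c * suc k) (v * suc k) (s k (suc n)) ⟩
    v * suc k + (c * suc k + s k (suc n)) ≡⟨ cong (v * suc k +_) (carry c n w 1+n≡base^c*w base∤w) ⟩
    v * suc k + suc (s k n)               ≡⟨ +-suc (v * suc k) (s k n) ⟩
    suc (v * suc k + s k n)               ≡⟨ cong suc legendre-n ⟩
    suc n                                 ∎
    where open ≡-Reasoning

prime[3] : Prime 3
prime[3] = from-yes (prime? 3)

∤-* : ∀ {p m n} → Prime p → ¬ p ∣ m → ¬ p ∣ n → ¬ p ∣ m * n
∤-* {m = m} {n} p-prime p∤m p∤n = [ p∤m , p∤n ] ∘ euclidsLemma m n p-prime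

∤-^ : ∀ {p m} → Prime p → ¬ p ∣ m → ∀ e → ¬ p ∣ m ^ e
∤-^ p-prime p∤m zero    p∣1 = ¬prime[1] (subst Prime (∣1⇒≡1 p∣1) p-prime)
∤-^ p-prime p∤m (suc e) = ∤-* p-prime p∤m (∤-^ p-prime p∤m e)

record Factorisation₂₃ (m : ℕ) : Set where
  constructor factorisation
  field
    e₂ e₃ u       : ℕ
    m≡2^e₂*3^e₃*u : m ≡ 2 ^ e₂ * 3 ^ e₃ * u
    2∤u           : ¬ 2 ∣ u
    3∤u           : ¬ 3 ∣ u

open Factorisation₂₃

smooth₂₃ : ∀ a b → Factorisation₂₃ (2 ^ a * 3 ^ b * 1)
smooth₂₃ a b = factorisation a b 1 refl (from-no (2 ∣? 1)) (from-no (3 ∣? 1))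

infixl 7 _*ᶠ_
_*ᶠ_ : ∀ {m n} → Factorisation₂₃ m → Factorisation₂₃ n → Factorisation₂₃ (m * n)
_*ᶠ_ {m} {n} (factorisation a b u m≡ 2∤u 3∤u) (factorisation c d w n≡ 2∤w 3∤w) =
  factorisation (a + c) (b + d) (u * w) m*n≡ (∤-* prime[2] 2∤u 2∤w) (∤-* prime[3] 3∤u 3∤w)
  where
  open ≡-Reasoning
  interchange : ∀ x y z x′ y′ z′ → x * y * z * (x′ * y′ * z′) ≡ x * x′ * (y * y′) * (z * z′)
  interchange = solve-∀
  m*n≡ : m * n ≡ 2 ^ (a + c) * 3 ^ (b + d) * (u * w)
  m*n≡ = begin
    m * n                                     ≡⟨ cong₂ _*_ m≡ n≡ ⟩
    2 ^ a * 3 ^ b * u * (2 ^ c * 3 ^ d * w)   ≡⟨ interchange (2 ^ a) (3 ^ b) u (2 ^ c) (3 ^ d) w ⟩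
    2 ^ a * 2 ^ c * (3 ^ b * 3 ^ d) * (u * w) ≡⟨ cong₂ (λ x y → x * y * (u * w)) (^-distribˡ-+-* 2 a c) (^-distribˡ-+-* 3 b d) ⟨
    2 ^ (a + c) * 3 ^ (b + d) * (u * w)       ∎

factorise₂₃ : ∀ m .{{_ : NonZero m}} → Factorisation₂₃ m
factorise₂₃ m = go m (<-wellFounded m)
  where
  go : ∀ m .{{_ : NonZero m}} → Acc _<_ m → Factorisation₂₃ m
  go m (acc rec) with 2 ∣? m | 3 ∣? m
  ... | yes 2∣m | _ = subst Factorisation₂₃ (sym (m∣n⇒n≡quotient*m 2∣m))
    (go (quotient 2∣m) {{quotient≢0 2∣m}} (rec (quotient-< 2∣m)) *ᶠ smooth₂₃ 1 0)
  ... | no 2∤m | yes 3∣m = subst Factorisation₂₃ (sym (m∣n⇒n≡quotient*m 3∣m))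
    (go (quotient 3∣m) {{quotient≢0 3∣m}} (rec (quotient-< 3∣m)) *ᶠ smooth₂₃ 0 1)
  ... | no 2∤m | no 3∤m = factorisation 0 0 m (sym (*-identityˡ m)) 2∤m 3∤m

legendre₂₃ : ∀ n → Σ (Factorisation₂₃ (n !)) λ F → e₂ F * 1 + s₂ n ≡ n × e₃ F * 2 + s₃ n ≡ n
legendre₂₃ zero = smooth₂₃ 0 0 , refl , refl
legendre₂₃ (suc n) with legendre₂₃ n | factorise₂₃ (suc n)
... | F , legendre₂ , legendre₃ | G@(factorisation c d w 1+n≡ 2∤w 3∤w) =
  G *ᶠ F ,
  legendre-step 0 c (3 ^ d * w) legendre₂ 1+n≡2^c*[3^d*w] (∤-* prime[2] (∤-^ prime[2] (from-no (2 ∣? 3)) d) 2∤w) ,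
  legendre-step 1 d (2 ^ c * w) legendre₃ 1+n≡3^d*[2^c*w] (∤-* prime[3] (∤-^ prime[3] (from-no (3 ∣? 2)) c) 3∤w)
  where
  swap : ∀ x y z → x * y * z ≡ y * (x * z)
  swap = solve-∀
  1+n≡2^c*[3^d*w] : suc n ≡ 2 ^ c * (3 ^ d * w)
  1+n≡2^c*[3^d*w] = trans 1+n≡ (*-assoc (2 ^ c) (3 ^ d) w)
  1+n≡3^d*[2^c*w] : suc n ≡ 3 ^ d * (2 ^ c * w)
  1+n≡3^d*[2^c*w] = trans 1+n≡ (swap (2 ^ c) (3 ^ d) w)

lastNZFuel-irrelevant : ∀ {f g} m → m ≤ f → m ≤ g → lastNZFuel f m ≡ lastNZFuel g m
lastNZFuel-irrelevant {zero}  {zero}  zero _ _ = refl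
lastNZFuel-irrelevant {zero}  {suc _} zero _ _ = refl
lastNZFuel-irrelevant {suc _} {zero}  zero _ _ = refl
lastNZFuel-irrelevant {suc _} {suc _} zero _ _ = refl
lastNZFuel-irrelevant {suc f} {suc g} m@(suc m-1) (s≤s m-1≤f) (s≤s m-1≤g) with m % 12 ≡ᵇ 0
... | true  = lastNZFuel-irrelevant (m / 12) (≤-trans m/12≤m-1 m-1≤f) (≤-trans m/12≤m-1 m-1≤g)
  where
  m/12≤m-1 : m / 12 ≤ m-1
  m/12≤m-1 = s≤s⁻¹ (m/n<m m 12 (s≤s (s≤s z≤n)))
... | false = refl

ℓ₁₂-residue : ∀ {m} → ¬ 12 ∣ m → ℓ₁₂ m ≡ m % 12
ℓ₁₂-residue {zero}      12∤0 = contradiction (12 ∣0) 12∤0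
ℓ₁₂-residue {m@(suc _)} 12∤m with m % 12 in m%12≡r
... | zero  = contradiction (m%n≡0⇒n∣m m 12 m%12≡r) 12∤m
... | suc _ = refl

ℓ₁₂-multiple : ∀ {m} .{{_ : NonZero m}} → 12 ∣ m → ℓ₁₂ m ≡ ℓ₁₂ (m / 12)
ℓ₁₂-multiple {m@(suc _)} 12∣m with m % 12 in m%12≡r
... | zero  = lastNZFuel-irrelevant (m / 12) (s≤s⁻¹ (m/n<m m 12 (s≤s (s≤s z≤n)))) ≤-refl
... | suc _ = contradiction (trans (sym m%12≡r) (n∣m⇒m%n≡0 m 12 12∣m)) λ ()

ℓ₁₂-*12 : ∀ m → ℓ₁₂ (m * 12) ≡ ℓ₁₂ m
ℓ₁₂-*12 zero      = refl
ℓ₁₂-*12 m@(suc _) = trans (ℓ₁₂-multiple (n∣m*n m)) (cong ℓ₁₂ (m*n/n≡m m 12))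

2∣12 : 2 ∣ 12
2∣12 = divides 6 refl

3∣12 : 3 ∣ 12
3∣12 = divides 4 refl

4∣12 : 4 ∣ 12
4∣12 = divides 3 refl

∣-ℓ₁₂ : ∀ {d m} → d ∣ 12 → d ∣ m → ¬ 12 ∣ m → d ∣ ℓ₁₂ m
∣-ℓ₁₂ d∣12 d∣m 12∤m = subst (_ ∣_) (sym (ℓ₁₂-residue 12∤m)) (%-presˡ-∣ d∣m d∣12)

∤-%12 : ∀ {d m} → d ∣ 12 → ¬ d ∣ m → ¬ d ∣ m % 12
∤-%12 d∣12 d∤m = d∤m ∘ ∣n∣m%n⇒∣m d∣12

Unit₁₂ : ℕ → Set
Unit₁₂ r = r ≡ 1 ⊎ r ≡ 5 ⊎ r ≡ 7 ⊎ r ≡ 11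

TwiceUnit₁₂ : ℕ → Set
TwiceUnit₁₂ r = r ≡ 2 ⊎ r ≡ 10

unit-residue : ∀ {r} → r < 12 → ¬ 2 ∣ r → ¬ 3 ∣ r → Unit₁₂ r
unit-residue {1}  _ _ _ = inj₁ refl
unit-residue {5}  _ _ _ = inj₂ (inj₁ refl)
unit-residue {7}  _ _ _ = inj₂ (inj₂ (inj₁ refl))
unit-residue {11} _ _ _ = inj₂ (inj₂ (inj₂ refl))
unit-residue {0}  _ 2∤r _ = contradiction (divides 0 refl) 2∤r
unit-residue {2}  _ 2∤r _ = contradiction (divides 1 refl) 2∤r
unit-residue {4}  _ 2∤r _ = contradiction (divides 2 refl) 2∤r
unit-residue {6}  _ 2∤r _ = contradiction (divides 3 refl) 2∤r
unit-residue {8}  _ 2∤r _ = contradiction (divides 4 refl) 2∤r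
unit-residue {10} _ 2∤r _ = contradiction (divides 5 refl) 2∤r
unit-residue {3}  _ _ 3∤r = contradiction (divides 1 refl) 3∤r
unit-residue {9}  _ _ 3∤r = contradiction (divides 3 refl) 3∤r
unit-residue {2+ (2+ (2+ (2+ (2+ (2+ r)))))} r<12 _ _ = contradiction r<12 (m+n≮m 12 r)

twice-unit : ∀ {r} → Unit₁₂ r → TwiceUnit₁₂ (2 * r % 12)
twice-unit (inj₁ refl)               = inj₁ refl
twice-unit (inj₂ (inj₁ refl))        = inj₂ refl
twice-unit (inj₂ (inj₂ (inj₁ refl))) = inj₁ refl
twice-unit (inj₂ (inj₂ (inj₂ refl))) = inj₂ refl

unit⇒¬twiceUnit : ∀ {r} → Unit₁₂ r → ¬ TwiceUnit₁₂ r
unit⇒¬twiceUnit (inj₁ refl)               = [ (λ ()) , (λ ()) ]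
unit⇒¬twiceUnit (inj₂ (inj₁ refl))        = [ (λ ()) , (λ ()) ]
unit⇒¬twiceUnit (inj₂ (inj₂ (inj₁ refl))) = [ (λ ()) , (λ ()) ]
unit⇒¬twiceUnit (inj₂ (inj₂ (inj₂ refl))) = [ (λ ()) , (λ ()) ]

unit⊎twiceUnit⇒∤ : ∀ {r} → Unit₁₂ r ⊎ TwiceUnit₁₂ r → ¬ (3 ∣ r ⊎ 4 ∣ r)
unit⊎twiceUnit⇒∤ (inj₁ (inj₁ refl))               = from-no (3 ∣? 1 ⊎-dec 4 ∣? 1)
unit⊎twiceUnit⇒∤ (inj₁ (inj₂ (inj₁ refl)))        = from-no (3 ∣? 5 ⊎-dec 4 ∣? 5)
unit⊎twiceUnit⇒∤ (inj₁ (inj₂ (inj₂ (inj₁ refl)))) = from-no (3 ∣? 7 ⊎-dec 4 ∣? 7)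
unit⊎twiceUnit⇒∤ (inj₁ (inj₂ (inj₂ (inj₂ refl)))) = from-no (3 ∣? 11 ⊎-dec 4 ∣? 11)
unit⊎twiceUnit⇒∤ (inj₂ (inj₁ refl))               = from-no (3 ∣? 2 ⊎-dec 4 ∣? 2)
unit⊎twiceUnit⇒∤ (inj₂ (inj₂ refl))               = from-no (3 ∣? 10 ⊎-dec 4 ∣? 10)

unit-ℓ₁₂ : ∀ {m} → ¬ 2 ∣ m → ¬ 3 ∣ m → Unit₁₂ (ℓ₁₂ m)
unit-ℓ₁₂ {m} 2∤m 3∤m = subst Unit₁₂ (sym (ℓ₁₂-residue (2∤m ∘ ∣-trans 2∣12)))
  (unit-residue (m%n<n m 12) (∤-%12 2∣12 2∤m) (∤-%12 3∣12 3∤m))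

twiceUnit-ℓ₁₂ : ∀ {u} → ¬ 2 ∣ u → ¬ 3 ∣ u → TwiceUnit₁₂ (ℓ₁₂ (2 * u))
twiceUnit-ℓ₁₂ {u} 2∤u 3∤u = subst TwiceUnit₁₂ (sym ℓ₁₂[2u]≡2[u%12]%12)
  (twice-unit (unit-residue (m%n<n u 12) (∤-%12 2∣12 2∤u) (∤-%12 3∣12 3∤u)))
  where
  3∤2u : ¬ 3 ∣ 2 * u
  3∤2u = ∤-* prime[3] (from-no (3 ∣? 2)) 3∤u
  ℓ₁₂[2u]≡2[u%12]%12 : ℓ₁₂ (2 * u) ≡ 2 * (u % 12) % 12
  ℓ₁₂[2u]≡2[u%12]%12 = trans (ℓ₁₂-residue (3∤2u ∘ ∣-trans 3∣12)) (%-distribˡ-* 2 u 12)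

-- a and b stand for the exponents of 2 and 3 in a number whose last nonzero base-12 digit is r.
LastDigitClass : ℕ → ℕ → ℕ → Set
LastDigitClass a b r =
  a ≡ b * 2 × Unit₁₂ r ⊎ a ≡ 1 + b * 2 × TwiceUnit₁₂ r ⊎ a ≢ b * 2 × a ≢ 1 + b * 2 × (3 ∣ r ⊎ 4 ∣ r)

shift-class : ∀ {a b r} → LastDigitClass a b r → LastDigitClass (2 + a) (1 + b) r
shift-class (inj₁ (a≡ , unit))               = inj₁ (cong (2 +_) a≡ , unit)
shift-class (inj₂ (inj₁ (a≡ , twice)))       = inj₂ (inj₁ (cong (2 +_) a≡ , twice))
shift-class (inj₂ (inj₂ (a≢ , a≢′ , 3∣∨4∣))) =
  inj₂ (inj₂ (a≢ ∘ suc-injective ∘ suc-injective , a≢′ ∘ suc-injective ∘ suc-injective , 3∣∨4∣))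

classify : ∀ a b {u} → ¬ 2 ∣ u → ¬ 3 ∣ u → LastDigitClass a b (ℓ₁₂ (2 ^ a * 3 ^ b * u))
classify 0 0 {u} 2∤u 3∤u =
  inj₁ (refl , subst (Unit₁₂ ∘ ℓ₁₂) (sym (*-identityˡ u)) (unit-ℓ₁₂ 2∤u 3∤u))
classify 1 0 2∤u 3∤u = inj₂ (inj₁ (refl , twiceUnit-ℓ₁₂ 2∤u 3∤u))
classify (2+ a) 0 {u} 2∤u 3∤u =
  inj₂ (inj₂ ((λ ()) , (λ ()) , inj₂ (∣-ℓ₁₂ 4∣12 4∣m (3∤m ∘ ∣-trans 3∣12))))
  where
  4∣m : 4 ∣ 2 ^ (2+ a) * 1 * u
  4∣m = ∣m⇒∣m*n u (∣m⇒∣m*n 1 (subst (4 ∣_) (*-assoc 2 2 (2 ^ a)) (m∣m*n (2 ^ a))))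
  3∤m : ¬ 3 ∣ 2 ^ (2+ a) * 1 * u
  3∤m = ∤-* prime[3] (∤-* prime[3] (∤-^ prime[3] (from-no (3 ∣? 2)) (2+ a)) (from-no (3 ∣? 1))) 3∤u
classify 0 (suc b) {u} 2∤u 3∤u =
  inj₂ (inj₂ ((λ ()) , (λ ()) , inj₁ (∣-ℓ₁₂ 3∣12 3∣m (2∤m ∘ ∣-trans 2∣12))))
  where
  3∣m : 3 ∣ 1 * 3 ^ suc b * u
  3∣m = ∣m⇒∣m*n u (∣n⇒∣m*n 1 (m∣m*n (3 ^ b)))
  2∤m : ¬ 2 ∣ 1 * 3 ^ suc b * u
  2∤m = ∤-* prime[2] (∤-* prime[2] (from-no (2 ∣? 1)) (∤-^ prime[2] (from-no (2 ∣? 3)) (suc b))) 2∤u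
classify 1 (suc b) {u} 2∤u 3∤u =
  inj₂ (inj₂ ((λ ()) , (λ ()) , inj₁ (∣-ℓ₁₂ 3∣12 3∣m (4∤m ∘ ∣-trans 4∣12))))
  where
  3∣m : 3 ∣ 2 * 3 ^ suc b * u
  3∣m = ∣m⇒∣m*n u (∣n⇒∣m*n 2 (m∣m*n (3 ^ b)))
  4∤m : ¬ 4 ∣ 2 * 3 ^ suc b * u
  4∤m 4∣m = ∤-* prime[2] (∤-^ prime[2] (from-no (2 ∣? 3)) (suc b)) 2∤u
              (*-cancelˡ-∣ 2 (subst (4 ∣_) (*-assoc 2 (3 ^ suc b) u) 4∣m))
classify (2+ a) (suc b) {u} 2∤u 3∤u =
  subst (LastDigitClass (2+ a) (suc b)) ℓ₁₂-strip12 (shift-class {a} {b} (classify a b 2∤u 3∤u))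
  where
  regroup : ∀ x y z → x * y * z * 12 ≡ 2 * (2 * x) * (3 * y) * z
  regroup = solve-∀
  ℓ₁₂-strip12 : ℓ₁₂ (2 ^ a * 3 ^ b * u) ≡ ℓ₁₂ (2 ^ (2+ a) * 3 ^ suc b * u)
  ℓ₁₂-strip12 = trans (sym (ℓ₁₂-*12 (2 ^ a * 3 ^ b * u))) (cong ℓ₁₂ (regroup (2 ^ a) (3 ^ b) u))

class⇒⇔ : ∀ {a b r} → LastDigitClass a b r → (Unit₁₂ r ⇔ a ≡ b * 2) × (TwiceUnit₁₂ r ⇔ a ≡ 1 + b * 2)
class⇒⇔ {b = b} (inj₁ (a≡2b , unit)) =
  mk⇔ (const a≡2b) (const unit) ,
  mk⇔ (⊥-elim ∘ unit⇒¬twiceUnit unit) (⊥-elim ∘ <⇒≢ (n<1+n (b * 2)) ∘ trans (sym a≡2b))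
class⇒⇔ {b = b} (inj₂ (inj₁ (a≡1+2b , twice))) =
  mk⇔ (λ unit → ⊥-elim (unit⇒¬twiceUnit unit twice))
      (λ a≡2b → ⊥-elim (<⇒≢ (n<1+n (b * 2)) (trans (sym a≡2b) a≡1+2b))) ,
  mk⇔ (const a≡1+2b) (const twice)
class⇒⇔ (inj₂ (inj₂ (a≢2b , a≢1+2b , 3∣∨4∣))) =
  mk⇔ (λ unit → ⊥-elim (unit⊎twiceUnit⇒∤ (inj₁ unit) 3∣∨4∣)) (⊥-elim ∘ a≢2b) ,
  mk⇔ (λ twice → ⊥-elim (unit⊎twiceUnit⇒∤ (inj₂ twice) 3∣∨4∣)) (⊥-elim ∘ a≢1+2b)

+-offset-⇔ : ∀ k {x y s t} → x + s ≡ y + t → x ≡ k + y ⇔ t ≡ k + s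
+-offset-⇔ k {x} {y} {s} {t} x+s≡y+t = mk⇔
  (λ x≡k+y → +-cancelˡ-≡ y t (k + s) (trans (sym x+s≡y+t) (trans (cong (_+ s) x≡k+y) (xy∙z≈y∙xz k y s))))
  (λ t≡k+s → +-cancelʳ-≡ s x (k + y) (trans x+s≡y+t (trans (cong (y +_) t≡k+s) (sym (xy∙z≈y∙xz k y s)))))

mainTheorem3 : (n : ℕ) → 1 ≤ n →
    ((ℓ₁₂ (n !) ≡ 1 ⊎ ℓ₁₂ (n !) ≡ 5 ⊎ ℓ₁₂ (n !) ≡ 7 ⊎ ℓ₁₂ (n !) ≡ 11) ⇔ (s₃ n ≡ s₂ n))
    × ((ℓ₁₂ (n !) ≡ 2 ⊎ ℓ₁₂ (n !) ≡ 10) ⇔ (s₃ n ≡ s₂ n + 1))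
mainTheorem3 n _ with legendre₂₃ n
... | factorisation a b u n!≡ 2∤u 3∤u , legendre₂ , legendre₃
  with class⇒⇔ {a} {b} (subst (LastDigitClass a b ∘ ℓ₁₂) (sym n!≡) (classify a b 2∤u 3∤u))
... | unit⇔a≡2b , twiceUnit⇔a≡1+2b =
  ⇔-trans unit⇔a≡2b (+-offset-⇔ 0 a+s₂≡2b+s₃) ,
  ⇔-trans twiceUnit⇔a≡1+2b (subst (λ z → a ≡ 1 + b * 2 ⇔ s₃ n ≡ z) (+-comm 1 (s₂ n)) (+-offset-⇔ 1 a+s₂≡2b+s₃))
  where
  a+s₂≡2b+s₃ : a + s₂ n ≡ b * 2 + s₃ n
  a+s₂≡2b+s₃ = trans (cong (_+ s₂ n) (sym (*-identityʳ a))) (trans legendre₂ (sym legendre₃))
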